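{- For every positive integer $m$, \[F(2m+2)-F(2m)=E\big(f_0(2m+2)-f_0(2m)+1\big),\] where $E(k)=2^k-k-1$.
   Context: Unlabeled chip-firing on the infinite rooted binary tree (every vertex has a left and a right child) with a self-loop at the root. Start with $N$ indistinguishable chips at the root. A vertex with at least $3$ chips may fire, sending one chip to each child and one to its parent (the root keeps that chip via its self-loop). The process reaches a unique stable configuration, and the number of times each vertex fires is independent of the order of fires. $f_0(N)$ is the number of times the root fires and $F(N)$ is the total number of fires (over all vertices) when starting with $N$ chips. $E(k)=2^k-k-1$ is OEIS sequence A000295. -}

module Defs where

open import Data.Nat using (ℕ; zero; suc; _+_; _*_; _∸_; _^_; _≤_; _<_)
open import Data.Bool using (Bool; true; false) renaming (_≟_ to _≟ᵇ_)
open import Data.List using (List; []; _∷_)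
open import Data.List.Properties using (≡-dec)
open import Data.Product using (Σ; _×_)
open import Relation.Nullary using (Dec; yes; no)
open import Relation.Binary.PropositionalEquality using (_≡_)

-- Vertices of the infinite rooted binary tree: the path from the root,
-- most recent step first.  The root is [], the two children of v are
-- (false ∷ v) (left) and (true ∷ v) (right); the parent of (b ∷ v) is v.
Vertex : Set
Vertex = List Bool

_≟V_ : (v w : Vertex) → Dec (v ≡ w)
_≟V_ = ≡-dec _≟ᵇ_

root : Vertex
root = []

Config : Set
Config = Vertex → ℕ

δ : Vertex → Vertex → ℕ
δ v w with v ≟V w
... | yes _ = 1
... | no  _ = 0

parentOf : Vertex → Vertex
parentOf []      = []      -- self-loop at the root
parentOf (_ ∷ v) = v

received : Vertex → Vertex → ℕ
received v w = δ (false ∷ v) w + δ (true ∷ v) w + δ (parentOf v) w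

fire : Vertex → Config → Config
fire v c w = (c w ∸ (3 * δ v w)) + received v w

initial : ℕ → Config
initial N w = N * δ root w

Stable : Config → Set
Stable c = (v : Vertex) → c v < 3

data Run : Config → ℕ → ℕ → Config → Set where
  done : ∀ {c} → Run c 0 0 c
  step : ∀ {c r t c'} (v : Vertex) → 3 ≤ c v →
         Run (fire v c) r t c' → Run c (δ root v + r) (suc t) c'

-- FireCounts N a A : starting from N chips at the root, some legal firing
-- sequence reaching a stable configuration fires the root a times and
-- fires A times in total.  (By the abelian property these are exactly
-- f₀(N) and F(N).)
FireCounts : ℕ → ℕ → ℕ → Set
FireCounts N a A = Σ Config (λ c' → Run (initial N) a A c' × Stable c')

-- E(k) = 2^k - k - 1  (A000295); truncated subtraction is exact since 2^k ≥ k+1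
E : ℕ → ℕ
E k = 2 ^ k ∸ k ∸ 1

-- The fire counts of a stabilising run do not depend on the order of the fires: a
-- vertex that is ready to fire fires in every stabilising run, and since fires at
-- distinct vertices commute it can be moved to the front. So it suffices to exhibit
-- one run for each N. All vertices of a level carry the same number of chips
-- throughout, and a level at depth d fires as a block of 2^d fires. From 2m chips one
-- reaches 2 chips on the root and at most 2 chips on every other vertex. Add two
-- chips to the root and let i be the number of levels just below it holding 2 chips.
-- Each time the root fires, level 1 reaches 3 chips and a wave starts: the full levels
-- fire once each in turn, the deepest one emptying and passing a chip down, so the
-- run of full levels shrinks by one. The root fires i + 1 times and, counting the
-- root, the waves through j = 0, …, i full levels cost 1 + 2 + … + 2^j fires each,
-- in total 2^(i+2) − (i+2) − 1.
module Submission where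

open import Defs
open import Data.Nat using (ℕ; zero; suc; _+_; _*_; _∸_; _^_; _≤_; _<_; z≤n; s≤s)
open import Data.Nat.Properties
open import Data.Nat.Tactic.RingSolver using (solve-∀)
open import Algebra.Properties.CommutativeSemigroup +-commutativeSemigroup
  using (xy∙z≈xz∙y; x∙yz≈y∙xz)
open import Data.Bool using (true; false)
open import Data.List using (List; []; _∷_; _++_; map; length; replicate)
open import Data.List.Properties
  using (length-++; length-map; map-++; map-∘; map-id; ∷-injectiveʳ; ++-assoc)
open import Data.List.Relation.Unary.All using (All; []; _∷_)
open import Data.List.Relation.Unary.All.Properties using (++⁺; replicate⁺)
open import Data.Product using (Σ; _×_; _,_)
open import Data.Empty using (⊥-elim)
open import Function using (_∘_)
open import Relation.Nullary using (Dec; yes; no)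
open import Relation.Binary.PropositionalEquality

δ-refl : ∀ v → δ v v ≡ 1
δ-refl v with v ≟V v
... | yes _ = refl
... | no v≢v = ⊥-elim (v≢v refl)

δ-≢ : ∀ {v w} → v ≢ w → δ v w ≡ 0
δ-≢ {v} {w} v≢w with v ≟V w
... | yes v≡w = ⊥-elim (v≢w v≡w)
... | no _ = refl

δ-injective : (f : Vertex → Vertex) → (∀ {v w} → f v ≡ f w → v ≡ w) →
              ∀ v w → δ (f v) (f w) ≡ δ v w
δ-injective f f-inj v w = by-cases (v ≟V w)
  where
  by-cases : Dec (v ≡ w) → δ (f v) (f w) ≡ δ v w
  by-cases (yes refl) = trans (δ-refl (f v)) (sym (δ-refl v))
  by-cases (no v≢w) = trans (δ-≢ (v≢w ∘ f-inj)) (sym (δ-≢ v≢w))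

3δ≤ : ∀ v (c : Config) → 3 ≤ c v → ∀ w → 3 * δ v w ≤ c w
3δ≤ v c h w = by-cases (v ≟V w)
  where
  by-cases : Dec (v ≡ w) → 3 * δ v w ≤ c w
  by-cases (yes refl) = subst (λ z → 3 * z ≤ c v) (sym (δ-refl v)) h
  by-cases (no v≢w) = subst (λ z → 3 * z ≤ c w) (sym (δ-≢ v≢w)) z≤n

fire-balance : ∀ v c → 3 ≤ c v → ∀ w → fire v c w + 3 * δ v w ≡ c w + received v w
fire-balance v c h w = begin
  (c w ∸ k) + R + k ≡⟨ +-assoc (c w ∸ k) R k ⟩
  (c w ∸ k) + (R + k) ≡⟨ cong ((c w ∸ k) +_) (+-comm R k) ⟩
  (c w ∸ k) + (k + R) ≡⟨ sym (+-assoc (c w ∸ k) k R) ⟩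
  (c w ∸ k) + k + R ≡⟨ cong (_+ R) (m∸n+n≡m (3δ≤ v c h w)) ⟩
  c w + R ∎
  where
  open ≡-Reasoning
  k = 3 * δ v w
  R = received v w

≤-fire : ∀ v (c : Config) {w} → v ≢ w → c w ≤ fire v c w
≤-fire v c {w} v≢w =
  subst (λ z → c w ≤ (c w ∸ 3 * z) + received v w) (sym (δ-≢ v≢w)) (m≤m+n (c w) _)

fire-cong : ∀ v {c d} → c ≗ d → fire v c ≗ fire v d
fire-cong v c≗d w = cong (λ z → (z ∸ 3 * δ v w) + received v w) (c≗d w)

fire-commute : ∀ u v (c : Config) → 3 ≤ c u → 3 ≤ c v → u ≢ v →
               fire v (fire u c) ≗ fire u (fire v c)
fire-commute u v c hu hv u≢v w = +-cancelʳ-≡ (3 * δ v w + 3 * δ u w) X Y (begin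
    X + (3 * δ v w + 3 * δ u w) ≡⟨ +-assoc X _ _ ⟨
    X + 3 * δ v w + 3 * δ u w ≡⟨ cong (_+ 3 * δ u w) (fire-balance v (fire u c) hv′ w) ⟩
    fire u c w + received v w + 3 * δ u w ≡⟨ xy∙z≈xz∙y (fire u c w) _ _ ⟩
    fire u c w + 3 * δ u w + received v w ≡⟨ cong (_+ received v w) (fire-balance u c hu w) ⟩
    c w + received u w + received v w ≡⟨ xy∙z≈xz∙y (c w) _ _ ⟩
    c w + received v w + received u w ≡⟨ cong (_+ received u w) (fire-balance v c hv w) ⟨
    fire v c w + 3 * δ v w + received u w ≡⟨ xy∙z≈xz∙y (fire v c w) _ _ ⟩
    fire v c w + received u w + 3 * δ v w ≡⟨ cong (_+ 3 * δ v w) (fire-balance u (fire v c) hu′ w) ⟨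
    Y + 3 * δ u w + 3 * δ v w ≡⟨ xy∙z≈xz∙y Y _ _ ⟩
    Y + 3 * δ v w + 3 * δ u w ≡⟨ +-assoc Y _ _ ⟩
    Y + (3 * δ v w + 3 * δ u w) ∎)
  where
  open ≡-Reasoning
  X = fire v (fire u c) w
  Y = fire u (fire v c) w
  hv′ : 3 ≤ fire u c v
  hv′ = ≤-trans hv (≤-fire u c u≢v)
  hu′ : 3 ≤ fire v c u
  hu′ = ≤-trans hu (≤-fire v c (u≢v ∘ sym))

Stable-cong : ∀ {c d} → c ≗ d → Stable c → Stable d
Stable-cong c≗d st v = subst (_< 3) (c≗d v) (st v)

-- Final configurations are only determined up to pointwise equality, since the
-- identities for fire hold pointwise and there is no function extensionality.
Run≗ : Config → ℕ → ℕ → Config → Set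
Run≗ c r t d = Σ Config λ c′ → Run c r t c′ × c′ ≗ d

Run≗-refl : ∀ {c} → Run≗ c 0 0 c
Run≗-refl = _ , done , λ _ → refl

Run-cong : ∀ {c r t c′ d} → Run c r t c′ → c ≗ d → Run≗ d r t c′
Run-cong done c≗d = _ , done , sym ∘ c≗d
Run-cong (step v h rest) c≗d with Run-cong rest (fire-cong v c≗d)
... | d′ , run′ , d′≗c′ = d′ , step v (subst (3 ≤_) (c≗d v) h) run′ , d′≗c′

Run≗-cong : ∀ {c d r t e} → c ≗ d → Run≗ c r t e → Run≗ d r t e
Run≗-cong c≗d (c′ , run , c′≗e) with Run-cong run c≗d
... | d′ , run′ , d′≗c′ = d′ , run′ , λ w → trans (d′≗c′ w) (c′≗e w)

Run≗-retarget : ∀ {c r t d e} → Run≗ c r t d → d ≗ e → Run≗ c r t e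
Run≗-retarget (c′ , run , c′≗d) d≗e = c′ , run , λ w → trans (c′≗d w) (d≗e w)

Run≗-step : ∀ {c r t d} v → 3 ≤ c v → Run≗ (fire v c) r t d → Run≗ c (δ root v + r) (suc t) d
Run≗-step v h (c′ , run , c′≗d) = c′ , step v h run , c′≗d

Run-++ : ∀ {c r t c′ r₂ t₂ c″} → Run c r t c′ → Run c′ r₂ t₂ c″ → Run c (r + r₂) (t + t₂) c″
Run-++ done q = q
Run-++ {c} {r₂ = r₂} {t₂} {c″} (step {r = r} {t} v h rest) q =
  subst (λ z → Run c z (suc (t + t₂)) c″) (sym (+-assoc (δ root v) r r₂))
        (step v h (Run-++ rest q))

Run≗-trans : ∀ {c r t d r₂ t₂ e} → Run≗ c r t d → Run≗ d r₂ t₂ e → Run≗ c (r + r₂) (t + t₂) e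
Run≗-trans (c′ , p , c′≗d) (d′ , q , d′≗e) with Run-cong q (sym ∘ c′≗d)
... | d″ , q′ , d″≗d′ = d″ , Run-++ p q′ , λ w → trans (d″≗d′ w) (d′≗e w)

Run-fireFirst : ∀ {c r t c′} → Run c r t c′ → Stable c′ → ∀ v → 3 ≤ c v →
  Σ ℕ λ r′ → Σ ℕ λ t′ → Run≗ (fire v c) r′ t′ c′ × r ≡ δ root v + r′ × t ≡ suc t′
Run-fireFirst done st v h = ⊥-elim (<⇒≱ (st v) h)
Run-fireFirst {c} (step u hu rest) st v hv with u ≟V v
... | yes refl = _ , _ , (_ , rest , λ _ → refl) , refl , refl
... | no u≢v with Run-fireFirst rest st v (≤-trans hv (≤-fire u c u≢v))
...   | r′ , t′ , rest′ , refl , refl =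
  δ root u + r′ , suc t′ ,
  Run≗-step u (≤-trans hu (≤-fire v c (u≢v ∘ sym)))
              (Run≗-cong (fire-commute u v c hu hv u≢v) rest′) ,
  x∙yz≈y∙xz (δ root u) (δ root v) r′ , refl

Run-unique : ∀ {c r t c′ d r₂ t₂ d′} → Run c r t c′ → Stable c′ → Run d r₂ t₂ d′ → Stable d′ →
             c ≗ d → r ≡ r₂ × t ≡ t₂
Run-unique done st done st₂ c≗d = refl , refl
Run-unique done st (step v h _) st₂ c≗d =
  ⊥-elim (<⇒≱ (st v) (subst (3 ≤_) (sym (c≗d v)) h))
Run-unique (step v h rest) st run₂ st₂ c≗d
  with Run-fireFirst run₂ st₂ v (subst (3 ≤_) (c≗d v) h)
... | r′ , t′ , (d″ , run′ , d″≗d′) , refl , refl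
  with Run-unique rest st run′ (Stable-cong (sym ∘ d″≗d′) st₂) (fire-cong v c≗d)
...   | refl , refl = refl , refl

_⊕_ : Config → Config → Config
(c ⊕ e) w = c w + e w

fire-⊕ : ∀ v (c e : Config) → 3 ≤ c v → fire v (c ⊕ e) ≗ fire v c ⊕ e
fire-⊕ v c e h w = +-cancelʳ-≡ (3 * δ v w) _ _ (begin
    fire v (c ⊕ e) w + 3 * δ v w ≡⟨ fire-balance v (c ⊕ e) (≤-trans h (m≤m+n _ _)) w ⟩
    c w + e w + received v w ≡⟨ xy∙z≈xz∙y (c w) _ _ ⟩
    c w + received v w + e w ≡⟨ cong (_+ e w) (fire-balance v c h w) ⟨
    fire v c w + 3 * δ v w + e w ≡⟨ xy∙z≈xz∙y (fire v c w) _ _ ⟩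
    fire v c w + e w + 3 * δ v w ∎)
  where
  open ≡-Reasoning

Run-⊕ : ∀ {c r t c′} → Run c r t c′ → (e : Config) → Run≗ (c ⊕ e) r t (c′ ⊕ e)
Run-⊕ done e = Run≗-refl
Run-⊕ {c} (step v h rest) e =
  Run≗-step v (≤-trans h (m≤m+n _ _)) (Run≗-cong (sym ∘ fire-⊕ v c e h) (Run-⊕ rest e))

occurrences : List Vertex → Vertex → ℕ
occurrences [] w = 0
occurrences (v ∷ S) w = δ v w + occurrences S w

rootFires : List Vertex → ℕ
rootFires [] = 0
rootFires (v ∷ S) = δ root v + rootFires S

receivedAll : List Vertex → Vertex → ℕ
receivedAll [] w = 0
receivedAll (v ∷ S) w = received v w + receivedAll S w

Run-fireAll : ∀ S (c : Config) → (∀ w → 3 * occurrences S w ≤ c w) →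
  Σ Config λ c′ → Run c (rootFires S) (length S) c′ ×
                  (∀ w → c′ w + 3 * occurrences S w ≡ c w + receivedAll S w)
Run-fireAll [] c _ = c , done , λ _ → refl
Run-fireAll (v ∷ S) c enough with Run-fireAll S (fire v c) enough′
  where
  enough′ : ∀ w → 3 * occurrences S w ≤ fire v c w
  enough′ w = begin
    3 * occurrences S w ≡⟨ m+n∸m≡n (3 * δ v w) _ ⟨
    3 * δ v w + 3 * occurrences S w ∸ 3 * δ v w
      ≡⟨ cong (_∸ 3 * δ v w) (*-distribˡ-+ 3 (δ v w) _) ⟨
    3 * (δ v w + occurrences S w) ∸ 3 * δ v w ≤⟨ ∸-monoˡ-≤ (3 * δ v w) (enough w) ⟩
    c w ∸ 3 * δ v w ≤⟨ m≤m+n _ (received v w) ⟩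
    fire v c w ∎
    where open ≤-Reasoning
... | c′ , run , balance = c′ , step v ready run , balance′
  where
  ready : 3 ≤ c v
  ready = ≤-trans (*-monoʳ-≤ 3 v-occurs) (enough v)
    where
    v-occurs : 1 ≤ δ v v + occurrences S v
    v-occurs = subst (λ z → 1 ≤ z + occurrences S v) (sym (δ-refl v)) (s≤s z≤n)
  balance′ : ∀ w → c′ w + 3 * (δ v w + occurrences S w)
                   ≡ c w + (received v w + receivedAll S w)
  balance′ w = begin
    c′ w + 3 * (δ v w + occurrences S w) ≡⟨ shuffle (c′ w) (δ v w) _ ⟩
    c′ w + 3 * occurrences S w + 3 * δ v w ≡⟨ cong (_+ 3 * δ v w) (balance w) ⟩
    fire v c w + receivedAll S w + 3 * δ v w ≡⟨ xy∙z≈xz∙y (fire v c w) _ _ ⟩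
    fire v c w + 3 * δ v w + receivedAll S w
      ≡⟨ cong (_+ receivedAll S w) (fire-balance v c ready w) ⟩
    c w + received v w + receivedAll S w ≡⟨ +-assoc (c w) _ _ ⟩
    c w + (received v w + receivedAll S w) ∎
    where
    open ≡-Reasoning
    shuffle : ∀ a b x → a + 3 * (b + x) ≡ a + 3 * x + 3 * b
    shuffle = solve-∀

occurrences-++ : ∀ S T w → occurrences (S ++ T) w ≡ occurrences S w + occurrences T w
occurrences-++ [] T w = refl
occurrences-++ (v ∷ S) T w =
  trans (cong (δ v w +_) (occurrences-++ S T w)) (sym (+-assoc (δ v w) _ _))

occurrences-map-injective : (f : Vertex → Vertex) → (∀ {v w} → f v ≡ f w → v ≡ w) →
                            ∀ S u → occurrences (map f S) (f u) ≡ occurrences S u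
occurrences-map-injective f f-inj [] u = refl
occurrences-map-injective f f-inj (v ∷ S) u =
  cong₂ _+_ (δ-injective f f-inj v u) (occurrences-map-injective f f-inj S u)

occurrences-map-∉ : ∀ (f : Vertex → Vertex) S w → (∀ v → f v ≢ w) →
                    occurrences (map f S) w ≡ 0
occurrences-map-∉ f [] w _ = refl
occurrences-map-∉ f (v ∷ S) w f≢w = cong₂ _+_ (δ-≢ (f≢w v)) (occurrences-map-∉ f S w f≢w)

receivedAll-split : ∀ S w → receivedAll S w ≡
  occurrences (map (false ∷_) S) w + occurrences (map (true ∷_) S) w + occurrences (map parentOf S) w
receivedAll-split [] w = refl
receivedAll-split (v ∷ S) w =
  trans (cong (received v w +_) (receivedAll-split S w))
        (regroup (δ (false ∷ v) w) (δ (true ∷ v) w) (δ (parentOf v) w) _ _ _)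
  where
  regroup : ∀ a b c x y z → a + b + c + (x + y + z) ≡ (a + x) + (b + y) + (c + z)
  regroup = solve-∀

δℕ : ℕ → ℕ → ℕ
δℕ zero zero = 1
δℕ zero (suc _) = 0
δℕ (suc _) zero = 0
δℕ (suc m) (suc n) = δℕ m n

3δℕ≤ : ∀ (f : ℕ → ℕ) n d → 3 ≤ f d → 3 * δℕ n d ≤ f n
3δℕ≤ f zero zero h = h
3δℕ≤ f zero (suc d) h = z≤n
3δℕ≤ f (suc n) zero h = z≤n
3δℕ≤ f (suc n) (suc d) h = 3δℕ≤ (f ∘ suc) n d h

-- Chips a vertex at depth n receives from its children when all vertices at
-- depth d fire; for d = 0 this is the root's chip returning through the self-loop.
upward : ℕ → ℕ → ℕ
upward zero n = δℕ n 0
upward (suc d) n = 2 * δℕ n d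

level : ℕ → List Vertex
level zero = root ∷ []
level (suc d) = map (false ∷_) (level d) ++ map (true ∷_) (level d)

length-level : ∀ d → length (level d) ≡ 2 ^ d
length-level zero = refl
length-level (suc d) = begin
  length (map (false ∷_) L ++ map (true ∷_) L) ≡⟨ length-++ (map (false ∷_) L) ⟩
  length (map (false ∷_) L) + length (map (true ∷_) L)
    ≡⟨ cong₂ _+_ (length-map (false ∷_) L) (length-map (true ∷_) L) ⟩
  length L + length L ≡⟨ cong (λ n → n + n) (length-level d) ⟩
  2 ^ d + 2 ^ d ≡⟨ cong (2 ^ d +_) (+-identityʳ (2 ^ d)) ⟨
  2 ^ suc d ∎
  where
  open ≡-Reasoning
  L = level d

rootFires-level : ∀ d → rootFires (level d) ≡ δℕ d 0
rootFires-level zero = refl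
rootFires-level (suc d) =
  trans (rootFires-++ (map (false ∷_) (level d)) _)
        (cong₂ _+_ (rootFires-map-∷ false (level d)) (rootFires-map-∷ true (level d)))
  where
  rootFires-++ : ∀ S T → rootFires (S ++ T) ≡ rootFires S + rootFires T
  rootFires-++ [] T = refl
  rootFires-++ (v ∷ S) T =
    trans (cong (δ root v +_) (rootFires-++ S T)) (sym (+-assoc (δ root v) _ _))
  rootFires-map-∷ : ∀ b S → rootFires (map (b ∷_) S) ≡ 0
  rootFires-map-∷ b [] = refl
  rootFires-map-∷ b (v ∷ S) = rootFires-map-∷ b S

occurrences-level : ∀ d w → occurrences (level d) w ≡ δℕ (length w) d
occurrences-level zero [] = refl
occurrences-level zero (_ ∷ _) = refl
occurrences-level (suc d) w = trans (occurrences-++ (map (false ∷_) L) _ w) (by-first-step w)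
  where
  L = level d
  by-first-step : ∀ w → occurrences (map (false ∷_) L) w + occurrences (map (true ∷_) L) w
                        ≡ δℕ (length w) (suc d)
  by-first-step [] =
    cong₂ _+_ (occurrences-map-∉ (false ∷_) L [] λ _ ()) (occurrences-map-∉ (true ∷_) L [] λ _ ())
  by-first-step (false ∷ u) =
    trans (cong₂ _+_ (occurrences-map-injective (false ∷_) ∷-injectiveʳ L u)
                     (occurrences-map-∉ (true ∷_) L (false ∷ u) λ _ ()))
          (trans (+-identityʳ _) (occurrences-level d u))
  by-first-step (true ∷ u) =
    trans (cong₂ _+_ (occurrences-map-∉ (false ∷_) L (true ∷ u) λ _ ())
                     (occurrences-map-injective (true ∷_) ∷-injectiveʳ L u))
          (occurrences-level d u)

occurrences-parents-level : ∀ d w → occurrences (map parentOf (level d)) w ≡ upward d (length w)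
occurrences-parents-level zero w = occurrences-level zero w
occurrences-parents-level (suc d) w = begin
  occurrences (map parentOf (map (false ∷_) L ++ map (true ∷_) L)) w
    ≡⟨ cong (λ S → occurrences S w) (map-++ parentOf (map (false ∷_) L) _) ⟩
  occurrences (map parentOf (map (false ∷_) L) ++ map parentOf (map (true ∷_) L)) w
    ≡⟨ cong (λ S → occurrences S w) (cong₂ _++_ (parents-map-∷ false) (parents-map-∷ true)) ⟩
  occurrences (L ++ L) w ≡⟨ occurrences-++ L L w ⟩
  occurrences L w + occurrences L w ≡⟨ cong (λ n → n + n) (occurrences-level d w) ⟩
  δℕ (length w) d + δℕ (length w) d ≡⟨ cong (δℕ (length w) d +_) (+-identityʳ _) ⟨
  2 * δℕ (length w) d ∎
  where
  open ≡-Reasoning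
  L = level d
  parents-map-∷ : ∀ b → map parentOf (map (b ∷_) L) ≡ L
  parents-map-∷ b = trans (sym (map-∘ L)) (map-id L)

receivedAll-level : ∀ d w → receivedAll (level d) w ≡ δℕ (length w) (suc d) + upward d (length w)
receivedAll-level d w =
  trans (receivedAll-split (level d) w) (cong₂ _+_ children (occurrences-parents-level d w))
  where
  children : occurrences (map (false ∷_) (level d)) w + occurrences (map (true ∷_) (level d)) w
             ≡ δℕ (length w) (suc d)
  children =
    trans (sym (occurrences-++ (map (false ∷_) (level d)) _ w)) (occurrences-level (suc d) w)

-- A profile p describes the configuration with p[n] chips on every vertex of
-- depth n; entries beyond the end of p are 0.
lookup₀ : List ℕ → ℕ → ℕ
lookup₀ [] _ = 0
lookup₀ (x ∷ p) zero = x
lookup₀ (x ∷ p) (suc n) = lookup₀ p n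

fromProfile : List ℕ → Config
fromProfile p v = lookup₀ p (length v)

subAt : ℕ → ℕ → List ℕ → List ℕ
subAt _ _ [] = []
subAt zero k (x ∷ p) = (x ∸ k) ∷ p
subAt (suc i) k (x ∷ p) = x ∷ subAt i k p

addAt : ℕ → ℕ → List ℕ → List ℕ
addAt zero k [] = k ∷ []
addAt (suc i) k [] = 0 ∷ addAt i k []
addAt zero k (x ∷ p) = (k + x) ∷ p
addAt (suc i) k (x ∷ p) = x ∷ addAt i k p

lookup₀-subAt : ∀ i k p n → lookup₀ (subAt i k p) n ≡ lookup₀ p n ∸ k * δℕ n i
lookup₀-subAt i k [] n = sym (0∸n≡0 (k * δℕ n i))
lookup₀-subAt zero k (x ∷ p) zero = cong (x ∸_) (sym (*-identityʳ k))
lookup₀-subAt zero k (x ∷ p) (suc n) = cong (lookup₀ p n ∸_) (sym (*-zeroʳ k))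
lookup₀-subAt (suc i) k (x ∷ p) zero = cong (x ∸_) (sym (*-zeroʳ k))
lookup₀-subAt (suc i) k (x ∷ p) (suc n) = lookup₀-subAt i k p n

lookup₀-addAt : ∀ i k p n → lookup₀ (addAt i k p) n ≡ k * δℕ n i + lookup₀ p n
lookup₀-addAt zero k [] zero = sym (trans (+-identityʳ _) (*-identityʳ k))
lookup₀-addAt zero k [] (suc n) = sym (trans (+-identityʳ _) (*-zeroʳ k))
lookup₀-addAt (suc i) k [] zero = sym (trans (+-identityʳ _) (*-zeroʳ k))
lookup₀-addAt (suc i) k [] (suc n) = lookup₀-addAt i k [] n
lookup₀-addAt zero k (x ∷ p) zero = cong (_+ x) (sym (*-identityʳ k))
lookup₀-addAt zero k (x ∷ p) (suc n) = cong (_+ lookup₀ p n) (sym (*-zeroʳ k))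
lookup₀-addAt (suc i) k (x ∷ p) zero = cong (_+ x) (sym (*-zeroʳ k))
lookup₀-addAt (suc i) k (x ∷ p) (suc n) = lookup₀-addAt i k p n

addUpward : ℕ → List ℕ → List ℕ
addUpward zero = addAt 0 1
addUpward (suc d) = addAt d 2

lookup₀-addUpward : ∀ d p n → lookup₀ (addUpward d p) n ≡ upward d n + lookup₀ p n
lookup₀-addUpward zero p n =
  trans (lookup₀-addAt 0 1 p n) (cong (_+ lookup₀ p n) (*-identityˡ _))
lookup₀-addUpward (suc d) p n = lookup₀-addAt d 2 p n

fireLevel : ℕ → List ℕ → List ℕ
fireLevel d p = addAt (suc d) 1 (addUpward d (subAt d 3 p))

fireLevel-balance : ∀ d p → 3 ≤ lookup₀ p d → ∀ n →
  lookup₀ (fireLevel d p) n + 3 * δℕ n d ≡ lookup₀ p n + (δℕ n (suc d) + upward d n)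
fireLevel-balance d p h n = begin
  lookup₀ (fireLevel d p) n + k
    ≡⟨ cong (_+ k) (lookup₀-addAt (suc d) 1 (addUpward d (subAt d 3 p)) n) ⟩
  1 * δℕ n (suc d) + lookup₀ (addUpward d (subAt d 3 p)) n + k
    ≡⟨ cong (λ x → 1 * δℕ n (suc d) + x + k) (lookup₀-addUpward d _ n) ⟩
  1 * δℕ n (suc d) + (upward d n + lookup₀ (subAt d 3 p) n) + k
    ≡⟨ cong (λ x → 1 * δℕ n (suc d) + (upward d n + x) + k) (lookup₀-subAt d 3 p n) ⟩
  1 * δℕ n (suc d) + (upward d n + (lookup₀ p n ∸ k)) + k
    ≡⟨ rearrange (δℕ n (suc d)) (upward d n) (lookup₀ p n ∸ k) k ⟩
  (lookup₀ p n ∸ k) + k + (δℕ n (suc d) + upward d n)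
    ≡⟨ cong (_+ (δℕ n (suc d) + upward d n)) (m∸n+n≡m (3δℕ≤ (lookup₀ p) n d h)) ⟩
  lookup₀ p n + (δℕ n (suc d) + upward d n) ∎
  where
  open ≡-Reasoning
  k = 3 * δℕ n d
  rearrange : ∀ a b x k → 1 * a + (b + x) + k ≡ x + k + (a + b)
  rearrange = solve-∀

Run-fireLevel : ∀ d p → 3 ≤ lookup₀ p d →
                Run≗ (fromProfile p) (δℕ d 0) (2 ^ d) (fromProfile (fireLevel d p))
Run-fireLevel d p h with Run-fireAll (level d) (fromProfile p) enough
  where
  enough : ∀ w → 3 * occurrences (level d) w ≤ fromProfile p w
  enough w = subst (λ k → 3 * k ≤ fromProfile p w) (sym (occurrences-level d w))
                   (3δℕ≤ (lookup₀ p) (length w) d h)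
... | c′ , run , balance =
  c′ , subst₂ (λ r t → Run (fromProfile p) r t c′) (rootFires-level d) (length-level d) run ,
  agrees
  where
  agrees : c′ ≗ fromProfile (fireLevel d p)
  agrees w = +-cancelʳ-≡ (3 * δℕ (length w) d) _ _ (begin
    c′ w + 3 * δℕ (length w) d ≡⟨ cong (λ k → c′ w + 3 * k) (occurrences-level d w) ⟨
    c′ w + 3 * occurrences (level d) w ≡⟨ balance w ⟩
    fromProfile p w + receivedAll (level d) w ≡⟨ cong (fromProfile p w +_) (receivedAll-level d w) ⟩
    fromProfile p w + (δℕ (length w) (suc d) + upward d (length w))
      ≡⟨ fireLevel-balance d p h (length w) ⟨
    fromProfile (fireLevel d p) w + 3 * δℕ (length w) d ∎)
    where open ≡-Reasoning

data LevelRun : List ℕ → ℕ → ℕ → List ℕ → Set where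
  done : ∀ {p} → LevelRun p 0 0 p
  step : ∀ {p r t p′} d → 3 ≤ lookup₀ p d → LevelRun (fireLevel d p) r t p′ →
         LevelRun p (δℕ d 0 + r) (2 ^ d + t) p′

LevelRun-++ : ∀ {p r t p′ r₂ t₂ p″} → LevelRun p r t p′ → LevelRun p′ r₂ t₂ p″ →
              LevelRun p (r + r₂) (t + t₂) p″
LevelRun-++ done q = q
LevelRun-++ {p} {r₂ = r₂} {t₂} {p″} (step {r = r} {t} d h rest) q =
  subst₂ (λ r t → LevelRun p r t p″) (sym (+-assoc (δℕ d 0) r r₂)) (sym (+-assoc (2 ^ d) t t₂))
         (step d h (LevelRun-++ rest q))

LevelRun⇒Run≗ : ∀ {p r t p′} → LevelRun p r t p′ → Run≗ (fromProfile p) r t (fromProfile p′)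
LevelRun⇒Run≗ done = Run≗-refl
LevelRun⇒Run≗ {p} (step d h rest) = Run≗-trans (Run-fireLevel d p h) (LevelRun⇒Run≗ rest)

fireLevel-++ : ∀ P y z q →
  fireLevel (suc (length P)) (P ++ y ∷ z ∷ q) ≡ P ++ (2 + y) ∷ (z ∸ 3) ∷ addAt 0 1 q
fireLevel-++ [] y z q = refl
fireLevel-++ (x ∷ P) y z q = cong (x ∷_) (fireLevel-++ P y z q)

lookup₀-++ : ∀ P y z q → lookup₀ (P ++ y ∷ z ∷ q) (suc (length P)) ≡ z
lookup₀-++ [] y z q = refl
lookup₀-++ (x ∷ P) y z q = lookup₀-++ P y z q

LevelRun-fire3 : ∀ P y q {r t p′} → LevelRun (P ++ (2 + y) ∷ 0 ∷ addAt 0 1 q) r t p′ →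
                 LevelRun (P ++ y ∷ 3 ∷ q) r (2 ^ suc (length P) + t) p′
LevelRun-fire3 P y q {r} {t} {p′} rest =
  step (suc (length P)) (≤-reflexive (sym (lookup₀-++ P y 3 q)))
       (subst (λ p → LevelRun p r t p′) (sym (fireLevel-++ P y 3 q)) rest)

-- Three chips at depth D = |P| + 1 above r levels holding 2 chips each: the
-- levels D, D + 1, …, D + r fire once each in turn.
LevelRun-wave : ∀ r P y x rest → Σ ℕ λ T →
  LevelRun (P ++ y ∷ 3 ∷ replicate r 2 ++ x ∷ rest) 0 T
           (P ++ (2 + y) ∷ replicate r 2 ++ 0 ∷ suc x ∷ rest) ×
  T + 2 ^ suc (length P) ≡ 2 ^ suc (length P) * 2 ^ suc r
LevelRun-wave zero P y x rest =
  _ , LevelRun-fire3 P y (x ∷ rest) done , double (2 ^ suc (length P))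
  where
  double : ∀ a → a + 0 + a ≡ a * 2
  double = solve-∀
LevelRun-wave (suc r) P y x rest with LevelRun-wave r (P ++ (2 + y) ∷ []) 0 x rest
... | T , run , count =
  2 ^ suc (length P) + T ,
  LevelRun-fire3 P y (2 ∷ replicate r 2 ++ x ∷ rest)
    (subst₂ (λ p p′ → LevelRun p 0 T p′) (++-assoc P _ _) (++-assoc P _ _) run) ,
  count′
  where
  D = 2 ^ suc (length P)
  count″ : T + 2 * D ≡ 2 * D * 2 ^ suc r
  count″ = subst (λ n → T + 2 ^ suc n ≡ 2 ^ suc n * 2 ^ suc r)
                 (trans (length-++ P) (+-comm (length P) 1)) count
  count′ : D + T + D ≡ D * 2 ^ suc (suc r)
  count′ = begin
    D + T + D ≡⟨ regroup D T ⟩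
    T + 2 * D ≡⟨ count″ ⟩
    2 * D * 2 ^ suc r ≡⟨ reassociate D (2 ^ suc r) ⟩
    D * 2 ^ suc (suc r) ∎
    where
    open ≡-Reasoning
    regroup : ∀ a b → a + b + a ≡ b + 2 * a
    regroup = solve-∀
    reassociate : ∀ a b → 2 * a * b ≡ a * (2 * b)
    reassociate = solve-∀

-- The root fires, a wave passes the first i levels, and what remains is the
-- same situation one level shorter.
LevelRun-cascade : ∀ i e x rest → Σ ℕ λ T →
  LevelRun ((3 + e) ∷ replicate i 2 ++ x ∷ rest) (suc i) T
           ((1 + e) ∷ replicate i 1 ++ suc x ∷ rest) ×
  T + suc (suc i) + 1 ≡ 2 ^ suc (suc i)
LevelRun-cascade zero e x rest = 1 , step 0 (m≤m+n 3 e) done , refl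
LevelRun-cascade (suc i) e x rest
  with LevelRun-wave i [] (1 + e) x rest | LevelRun-cascade i e 0 (suc x ∷ rest)
... | Tw , wave , countw | Tc , cascade , countc =
  1 + (Tw + Tc) ,
  step 0 (m≤m+n 3 e) (LevelRun-++ wave
    (subst (λ q → LevelRun ((3 + e) ∷ replicate i 2 ++ 0 ∷ suc x ∷ rest) (suc i) Tc
                           ((1 + e) ∷ q))
           (replicate-++-∷ i (suc x ∷ rest)) cascade)) ,
  count
  where
  replicate-++-∷ : ∀ j q → replicate j 1 ++ 1 ∷ q ≡ 1 ∷ replicate j 1 ++ q
  replicate-++-∷ zero q = refl
  replicate-++-∷ (suc j) q = cong (1 ∷_) (replicate-++-∷ j q)
  count : 1 + (Tw + Tc) + suc (suc (suc i)) + 1 ≡ 2 ^ suc (suc (suc i))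
  count = begin
    1 + (Tw + Tc) + suc (suc (suc i)) + 1 ≡⟨ regroup Tw Tc i ⟩
    (Tw + 2) + (Tc + suc (suc i) + 1) ≡⟨ cong₂ _+_ countw countc ⟩
    2 * 2 ^ suc i + 2 * 2 ^ suc i ≡⟨ doubling (2 ^ suc i) ⟩
    2 ^ suc (suc (suc i)) ∎
    where
    open ≡-Reasoning
    regroup : ∀ a b i → 1 + (a + b) + suc (suc (suc i)) + 1 ≡ (a + 2) + (b + suc (suc i) + 1)
    regroup = solve-∀
    doubling : ∀ y → 2 * y + 2 * y ≡ 2 * (2 * y)
    doubling = solve-∀

E-from-sum : ∀ k T → T + k + 1 ≡ 2 ^ k → T ≡ E k
E-from-sum k T sum = sym (begin
  2 ^ k ∸ k ∸ 1 ≡⟨ cong (λ n → n ∸ k ∸ 1) sum ⟨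
  T + k + 1 ∸ k ∸ 1 ≡⟨ cong (λ n → n ∸ k ∸ 1) (xy∙z≈xz∙y T k 1) ⟩
  T + 1 + k ∸ k ∸ 1 ≡⟨ cong (_∸ 1) (m+n∸n≡m (T + 1) k) ⟩
  T + 1 ∸ 1 ≡⟨ m+n∸n≡m T 1 ⟩
  T ∎)
  where open ≡-Reasoning

lookup₀-All : ∀ {P : ℕ → Set} {p} → P 0 → All P p → ∀ n → P (lookup₀ p n)
lookup₀-All P0 [] n = P0
lookup₀-All P0 (Px ∷ _) zero = Px
lookup₀-All P0 (_ ∷ Pp) (suc n) = lookup₀-All P0 Pp n

lookup₀-++-0 : ∀ p n → lookup₀ (p ++ 0 ∷ []) n ≡ lookup₀ p n
lookup₀-++-0 [] zero = refl
lookup₀-++-0 [] (suc n) = refl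
lookup₀-++-0 (x ∷ p) zero = refl
lookup₀-++-0 (x ∷ p) (suc n) = lookup₀-++-0 p n

-- Padding with a 0 guarantees an entry different from 2.
split-at-first-non-2 : ∀ p → All (_≤ 2) p → Σ ℕ λ i → Σ ℕ λ x → Σ (List ℕ) λ rest →
  p ++ 0 ∷ [] ≡ replicate i 2 ++ x ∷ rest × x ≤ 1 × All (_≤ 2) rest
split-at-first-non-2 [] [] = 0 , 0 , [] , refl , z≤n , []
split-at-first-non-2 (x ∷ p) (x≤2 ∷ p≤2) with x ≟ 2
... | no x≢2 = 0 , x , p ++ 0 ∷ [] , refl , ≤-pred (≤∧≢⇒< x≤2 x≢2) , ++⁺ p≤2 (z≤n ∷ [])
... | yes refl with split-at-first-non-2 p p≤2
...   | i , y , rest , eq , y≤1 , rest≤2 = suc i , y , rest , cong (2 ∷_) eq , y≤1 , rest≤2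

fromProfile-⊕-initial : ∀ x p k → fromProfile (x ∷ p) ⊕ initial k ≗ fromProfile ((x + k) ∷ p)
fromProfile-⊕-initial x p k [] = cong (x +_) (*-identityʳ k)
fromProfile-⊕-initial x p k (_ ∷ u) =
  trans (cong (lookup₀ p (length u) +_) (*-zeroʳ k)) (+-identityʳ _)

-- The final configuration is stable, so r and t are f₀(N) and F(N).
ProfileRun : ℕ → ℕ → ℕ → Set
ProfileRun N r t = Σ (List ℕ) λ p → All (_≤ 2) p × Run≗ (initial N) r t (fromProfile (2 ∷ p))

FireCounts-unique : ∀ N {a A r t} → FireCounts N a A → ProfileRun N r t → a ≡ r × A ≡ t
FireCounts-unique _ (_ , run , stable) (p , p≤2 , c′ , run′ , c′≗p) =
  Run-unique run stable run′ (Stable-cong (sym ∘ c′≗p) profile-stable) (λ _ → refl)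
  where
  profile-stable : Stable (fromProfile (2 ∷ p))
  profile-stable v = s≤s (lookup₀-All z≤n (≤-refl ∷ p≤2) (length v))

-- Two more chips on the root start a cascade down the initial run of full levels.
ProfileRun-+2 : ∀ N {r t} → ProfileRun N r t →
                Σ ℕ λ i → ProfileRun (N + 2) (r + suc i) (t + E (suc (suc i)))
ProfileRun-+2 N {r} {t} (p , p≤2 , c , run , c≗p)
  with split-at-first-non-2 p p≤2
... | i , x , rest , split , x≤1 , rest≤2 with LevelRun-cascade i 1 x rest
...   | T , cascade , count =
  i , replicate i 1 ++ suc x ∷ rest , ++⁺ (replicate⁺ i (s≤s z≤n)) (s≤s x≤1 ∷ rest≤2) ,
  subst (λ T → Run≗ (initial (N + 2)) (r + suc i) (t + T) _) (E-from-sum (suc (suc i)) T count)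
        (Run≗-trans withTwoMore (LevelRun⇒Run≗ cascade))
  where
  withTwoMore : Run≗ (initial (N + 2)) r t (fromProfile (4 ∷ replicate i 2 ++ x ∷ rest))
  withTwoMore = Run≗-retarget (Run≗-cong initial-+ (Run-⊕ run (initial 2))) profile
    where
    initial-+ : initial N ⊕ initial 2 ≗ initial (N + 2)
    initial-+ w = sym (*-distribʳ-+ (δ root w) N 2)
    profile : c ⊕ initial 2 ≗ fromProfile (4 ∷ replicate i 2 ++ x ∷ rest)
    profile w =
      trans (cong (_+ initial 2 w) (c≗p w)) (trans (fromProfile-⊕-initial 2 p 2 w) (padding w))
      where
      padding : fromProfile (4 ∷ p) ≗ fromProfile (4 ∷ replicate i 2 ++ x ∷ rest)
      padding [] = refl
      padding (_ ∷ u) =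
        trans (sym (lookup₀-++-0 p (length u))) (cong (λ q → lookup₀ q (length u)) split)

ProfileRun-even : ∀ m → Σ ℕ λ r → Σ ℕ λ t → ProfileRun (2 * suc m) r t
ProfileRun-even zero = 0 , 0 , [] , [] , Run≗-retarget Run≗-refl two-at-root
  where
  two-at-root : initial 2 ≗ fromProfile (2 ∷ [])
  two-at-root [] = refl
  two-at-root (_ ∷ _) = refl
ProfileRun-even (suc m) with ProfileRun-even m
... | r , t , run with ProfileRun-+2 (2 * suc m) run
...   | i , run′ = r + suc i , t + E (suc (suc i)) ,
  subst (λ N → ProfileRun N (r + suc i) (t + E (suc (suc i))))
        (trans (+-comm (2 * suc m) 2) (sym (*-suc 2 (suc m)))) run′

mainTheorem19 : (m : ℕ) → 1 ≤ m →
    (a A b B : ℕ) → FireCounts (2 * m + 2) a A → FireCounts (2 * m) b B →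
      Σ ℕ (λ k → (k + b ≡ a + 1) × (A ≡ B + E k))
mainTheorem19 (suc m) _ a A b B fromTwoMore fromEven with ProfileRun-even m
... | r , t , run with ProfileRun-+2 (2 * suc m) run
...   | i , run′ with FireCounts-unique (2 * suc m) fromEven run
                                          | FireCounts-unique (2 * suc m + 2) fromTwoMore run′
...     | refl , refl | refl , refl = suc (suc i) , rearrange i r , refl
  where
  rearrange : ∀ i r → suc (suc i) + r ≡ r + suc i + 1
  rearrange = solve-∀
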